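{- There exists an infinite family of matrices $M\in\Sigma^{n\times n}$ with $\delta_{2D}(M)=O(1)$ such that the 2D-BT of $M$ has $\Omega(\sqrt{n})$ marked nodes on a single level.
   Context: For $k'\in[1,n]$ let $d_{k'\times k'}(M)$ be the number of distinct $k'\times k'$ submatrices (contiguous square blocks) of $M$, and $\delta_{2D}(M)=\max\{d_{k'\times k'}(M)/k'^2 : k'\in[1,n]\}$. The first occurrence of a square matrix $X$ in $M$ is the occurrence whose top-left corner comes first in row-major order. The 2D-BT of $M$ with integer parameter $k\ge2$, for $n=k^\beta$: the root (level 0, marked) represents $M$. At level $\ell\ge1$, a block is a submatrix of size $(n/k^\ell)\times(n/k^\ell)$ with top-left corner $(1+\lambda n/k^\ell,1+\mu n/k^\ell)$, $\lambda,\mu\ge0$ integers; the nodes at level $\ell$ are the $k^2$ blocks partitioning the block of each marked node at level $\ell-1$. A node at level $\ell$ is marked iff its block shares at least one cell with the first occurrence of some $(n/k^\ell)\times(n/k^\ell)$ submatrix of $M$; only marked nodes are recursively split; unmarked nodes are leaves pointing to the marked nodes overlapping the first occurrence of their block. -}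

module Defs where

open import Data.Nat using (ℕ; zero; suc; _+_; _*_; _∸_; _^_; _≤_; _<_)
open import Data.Fin using (Fin)
import Data.Fin.Properties as FinP
open import Data.List using (List; _∷_; []; map; upTo; concatMap; length; deduplicate)
import Data.List.Properties as ListP
open import Data.Product using (Σ; ∃; _×_; _,_)
open import Data.Sum using (_⊎_)
open import Relation.Binary.PropositionalEquality using (_≡_; _≢_)

-- A matrix over the alphabet Fin σ, given by its entries; indices are
-- 0-based and only entries (i , j) with i , j < n are meaningful for an
-- n × n matrix (all definitions below only read those entries).
Matrix : ℕ → Set
Matrix σ = ℕ → ℕ → Fin σ

sub : ∀ {σ} → Matrix σ → ℕ → ℕ → ℕ → List (List (Fin σ))
sub M s i j = map (λ a → map (λ b → M (i + a) (j + b)) (upTo s)) (upTo s)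

positions : ℕ → ℕ → List (ℕ × ℕ)
positions n s = concatMap (λ i → map (λ j → (i , j)) (upTo m)) (upTo m)
  where m = suc (n ∸ s)

d : ∀ {σ} → Matrix σ → ℕ → ℕ → ℕ
d {σ} M n s = length (deduplicate (ListP.≡-dec (ListP.≡-dec FinP._≟_))
                        (map (λ p → sub M s (Data.Product.proj₁ p) (Data.Product.proj₂ p))
                             (positions n s)))

-- δ_2D(M) ≤ c, i.e. max_{s ∈ [1,n]} d_{s×s}(M) / s² ≤ c.
δ2D≤ : ∀ {σ} → Matrix σ → ℕ → ℕ → Set
δ2D≤ M n c = ∀ s → 1 ≤ s → s ≤ n → d M n s ≤ c * (s * s)

Before : ℕ × ℕ → ℕ × ℕ → Set
Before (i' , j') (i , j) = i' < i ⊎ (i' ≡ i × j' < j)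

FirstOcc : ∀ {σ} → Matrix σ → ℕ → ℕ → ℕ → ℕ → Set
FirstOcc M n s i j =
  i + s ≤ n × j + s ≤ n ×
  (∀ i' j' → i' + s ≤ n → j' + s ≤ n → Before (i' , j') (i , j) →
     sub M s i' j' ≢ sub M s i j)

ShareCell : ℕ → ℕ → ℕ → ℕ → ℕ → Set
ShareCell s i j i' j' = ∃ λ a → ∃ λ b →
  (i ≤ a × a < i + s × i' ≤ a × a < i' + s) ×
  (j ≤ b × b < j + s × j' ≤ b × b < j' + s)

-- Marked nodes of the 2D-BT with parameter k of the n × n matrix M,
-- n = k ^ β.  Marked ℓ x y : the node at level ℓ whose block has top-left
-- corner (x · k^(β-ℓ) , y · k^(β-ℓ)) (0-based) exists and is marked.
data Marked {σ} (k β : ℕ) (M : Matrix σ) : ℕ → ℕ → ℕ → Set where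
  root  : Marked k β M 0 0 0
  child : ∀ {ℓ x y a b} → Marked k β M ℓ x y → suc ℓ ≤ β → a < k → b < k →
          (let s = k ^ (β ∸ suc ℓ) in
           ∃ λ i → ∃ λ j → FirstOcc M (k ^ β) s i j ×
             ShareCell s ((x * k + a) * s) ((y * k + b) * s) i j) →
          Marked k β M (suc ℓ) (x * k + a) (y * k + b)

-- Let n = s₀ · s₀ with s₀ = k ^ γ, and let every row of M be one 0/1 string cut
-- into blocks of length s₀: block 2v+1 has its ones at offsets 0 and v+1, even
-- blocks are zero.  A window of length s < s₀ meets at most two consecutive
-- blocks, one of which is zero, so it contains at most two ones and there are
-- at most (s+1)² distinct s × s submatrices; for s ≥ s₀ there are at most
-- n ≤ s² of them.  On the other hand the block of columns starting at (2v+1) s₀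
-- is the first occurrence of its content for every side s ≥ s₀: an earlier
-- window sharing its leading one has its second one at the wrong offset.  So
-- the node containing column (2v+1) s₀ is marked on every level down to level
-- γ, where the blocks have side s₀; taking v < k ^ (γ ∸ 2) gives √n / k²
-- marked nodes on that level.
module Submission where

open import Defs
open import Data.Nat using (ℕ; _*_; _^_; _≤_)
open import Data.List using (List; length)
open import Data.List.Relation.Unary.All using (All)
open import Data.List.Relation.Unary.Unique.Propositional using (Unique)
open import Data.Product using (Σ; ∃; _×_; _,_; proj₁; proj₂)

open import Data.Nat
open import Data.Nat.Properties
open import Data.Nat.DivMod
open import Data.Nat.Divisibility using (n∣m*n)
open import Data.Nat.Tactic.RingSolver using (solve-∀)
open import Algebra.Properties.CommutativeSemigroup +-commutativeSemigroup
  using () renaming (interchange to +-interchange; xy∙z≈xz∙y to +-right-comm)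
open import Data.Bool using (Bool; true; false; _∨_; not; if_then_else_)
open import Data.Bool.Properties using (∨-identityʳ; T-≡; not-¬)
open import Data.Maybe using (Maybe; just; nothing)
open import Data.Maybe.Properties using (just-injective)
import Data.Maybe as Maybe
import Data.Maybe.Relation.Unary.All as MaybeAll
open import Data.Vec using (Vec; []; _∷_; replicate)
import Data.Vec as Vec
import Data.Vec.Relation.Unary.All as VecAll
import Data.Vec.Relation.Unary.All.Properties as VecAllP
open import Data.Fin using (Fin)
import Data.Fin.Properties as FinP
open import Data.List using ([]; _∷_; map; upTo; applyUpTo; cartesianProduct; deduplicate; _++_)
import Data.List.Properties as ListP
open import Data.List.Membership.Propositional using (_∈_)
open import Data.List.Membership.Propositional.Properties
open import Data.List.Relation.Binary.Subset.Propositional using (_⊆_)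
open import Data.List.Relation.Unary.Any using (here; there)
import Data.List.Relation.Unary.Any as Any
import Data.List.Relation.Unary.All as All
import Data.List.Relation.Unary.All.Properties as AllP
open import Data.List.Relation.Unary.AllPairs using (_∷_)
import Data.List.Relation.Unary.Unique.Propositional.Properties as UniqueP
open import Data.List.Relation.Unary.Unique.DecPropositional.Properties using (deduplicate-!)
open import Data.Sum using (_⊎_; inj₁; inj₂)
open import Function using (_∘_; _$_; Equivalence)
open import Relation.Binary.PropositionalEquality
open import Relation.Nullary using (contradiction; yes; no)

≡ᵇ-refl : ∀ n → (n ≡ᵇ n) ≡ true
≡ᵇ-refl n = Equivalence.to T-≡ (≡⇒≡ᵇ n n refl)

≡ᵇ-true : ∀ {m n} → (m ≡ᵇ n) ≡ true → m ≡ n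
≡ᵇ-true e = ≡ᵇ⇒≡ _ _ (Equivalence.from T-≡ e)

≡ᵇ-≢ : ∀ {m n} → m ≢ n → (m ≡ᵇ n) ≡ false
≡ᵇ-≢ {zero}  {zero}  m≢n = contradiction refl m≢n
≡ᵇ-≢ {zero}  {suc _} _   = refl
≡ᵇ-≢ {suc _} {zero}  _   = refl
≡ᵇ-≢ {suc m} {suc n} m≢n = ≡ᵇ-≢ (m≢n ∘ cong suc)

^-∸-suc : ∀ k {β ℓ} → ℓ < β → k ^ (β ∸ ℓ) ≡ k * k ^ (β ∸ suc ℓ)
^-∸-suc k ℓ<β = cong (k ^_) (+-∸-assoc 1 ℓ<β)

+-≤-of-*-≤ : ∀ {a b n k} → 2 ≤ k → a * k ≤ n → b * k ≤ n → a + b ≤ n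
+-≤-of-*-≤ {a} {b} {n} {k} 2≤k ak≤n bk≤n =
  *-cancelʳ-≤ (a + b) n k {{>-nonZero (≤-trans (s≤s z≤n) 2≤k)}} $ begin
    (a + b) * k    ≡⟨ *-distribʳ-+ k a b ⟩
    a * k + b * k  ≤⟨ +-mono-≤ ak≤n bk≤n ⟩
    n + n          ≡⟨ cong (n +_) (sym (+-identityʳ n)) ⟩
    2 * n          ≤⟨ *-monoˡ-≤ n 2≤k ⟩
    k * n          ≡⟨ *-comm k n ⟩
    n * k          ∎
  where open ≤-Reasoning

-- Sequences with few true values

oneIf : Bool → ℕ
oneIf b = if b then 1 else 0

oneIf-∨ : ∀ x y → oneIf (x ∨ y) ≤ oneIf x + oneIf y
oneIf-∨ true  _ = s≤s z≤n
oneIf-∨ false _ = ≤-refl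

countTrue : (ℕ → Bool) → ℕ → ℕ
countTrue g zero    = 0
countTrue g (suc s) = oneIf (g 0) + countTrue (g ∘ suc) s

countTrue-cong : ∀ s {g h : ℕ → Bool} → (∀ b → b < s → g b ≡ h b) →
                 countTrue g s ≡ countTrue h s
countTrue-cong zero    _ = refl
countTrue-cong (suc s) e =
  cong₂ _+_ (cong oneIf (e 0 (s≤s z≤n))) (countTrue-cong s (λ b b<s → e (suc b) (s≤s b<s)))

countTrue-+ : ∀ a c g → countTrue g (a + c) ≡ countTrue g a + countTrue (λ b → g (a + b)) c
countTrue-+ zero    c g = refl
countTrue-+ (suc a) c g =
  trans (cong (oneIf (g 0) +_) (countTrue-+ a c (g ∘ suc))) (sym (+-assoc (oneIf (g 0)) _ _))

countTrue-mono : ∀ {a b} g → a ≤ b → countTrue g a ≤ countTrue g b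
countTrue-mono g z≤n       = z≤n
countTrue-mono g (s≤s a≤b) = +-monoʳ-≤ (oneIf (g 0)) (countTrue-mono (g ∘ suc) a≤b)

countTrue-false : ∀ s → countTrue (λ _ → false) s ≡ 0
countTrue-false zero    = refl
countTrue-false (suc s) = countTrue-false s

countTrue-∨ : ∀ s g h → countTrue (λ b → g b ∨ h b) s ≤ countTrue g s + countTrue h s
countTrue-∨ zero    g h = z≤n
countTrue-∨ (suc s) g h = begin
  oneIf (g 0 ∨ h 0) + countTrue (λ b → g (suc b) ∨ h (suc b)) s
    ≤⟨ +-mono-≤ (oneIf-∨ (g 0) (h 0)) (countTrue-∨ s (g ∘ suc) (h ∘ suc)) ⟩
  (oneIf (g 0) + oneIf (h 0)) + (countTrue (g ∘ suc) s + countTrue (h ∘ suc) s)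
    ≡⟨ +-interchange (oneIf (g 0)) (oneIf (h 0)) (countTrue (g ∘ suc) s) (countTrue (h ∘ suc) s) ⟩
  (oneIf (g 0) + countTrue (g ∘ suc) s) + (oneIf (h 0) + countTrue (h ∘ suc) s)
    ∎
  where open ≤-Reasoning

countTrue-≡ᵇ : ∀ c s → countTrue (_≡ᵇ c) s ≤ 1
countTrue-≡ᵇ c       zero    = z≤n
countTrue-≡ᵇ zero    (suc s) = s≤s (≤-reflexive (countTrue-false s))
countTrue-≡ᵇ (suc c) (suc s) = countTrue-≡ᵇ c s

hit : Maybe ℕ → ℕ → Bool
hit nothing  _ = false
hit (just c) b = b ≡ᵇ c

hits : ∀ {t} → Vec (Maybe ℕ) t → ℕ → Bool
hits []       _ = false
hits (o ∷ os) b = hit o b ∨ hits os b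

countTrue-hit : ∀ o s → countTrue (hit o) s ≤ 1
countTrue-hit nothing  s = ≤-trans (≤-reflexive (countTrue-false s)) z≤n
countTrue-hit (just c) s = countTrue-≡ᵇ c s

countTrue-hits : ∀ {t} (os : Vec (Maybe ℕ) t) s → countTrue (hits os) s ≤ t
countTrue-hits []       s = ≤-reflexive (countTrue-false s)
countTrue-hits (o ∷ os) s =
  ≤-trans (countTrue-∨ s (hit o) (hits os)) (+-mono-≤ (countTrue-hit o s) (countTrue-hits os s))

Below : ℕ → Maybe ℕ → Set
Below s = MaybeAll.All (_< s)

shift : Maybe ℕ → Maybe ℕ
shift = Maybe.map suc

hit-shift-zero : ∀ o → hit (shift o) 0 ≡ false
hit-shift-zero nothing  = refl
hit-shift-zero (just _) = refl

hit-shift-suc : ∀ o b → hit (shift o) (suc b) ≡ hit o b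
hit-shift-suc nothing  _ = refl
hit-shift-suc (just _) _ = refl

hits-shift-zero : ∀ {t} (os : Vec (Maybe ℕ) t) → hits (Vec.map shift os) 0 ≡ false
hits-shift-zero []       = refl
hits-shift-zero (o ∷ os) = cong₂ _∨_ (hit-shift-zero o) (hits-shift-zero os)

hits-shift-suc : ∀ {t} (os : Vec (Maybe ℕ) t) b → hits (Vec.map shift os) (suc b) ≡ hits os b
hits-shift-suc []       _ = refl
hits-shift-suc (o ∷ os) b = cong₂ _∨_ (hit-shift-suc o b) (hits-shift-suc os b)

Below-shift : ∀ {s o} → Below s o → Below (suc s) (shift o)
Below-shift (MaybeAll.just c<s) = MaybeAll.just (s≤s c<s)
Below-shift MaybeAll.nothing    = MaybeAll.nothing

Below-shifts : ∀ {s t} {os : Vec (Maybe ℕ) t} →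
               VecAll.All (Below s) os → VecAll.All (Below (suc s)) (Vec.map shift os)
Below-shifts os<s = VecAllP.map⁺ (VecAll.map Below-shift os<s)

Below-nothings : ∀ {s} t → VecAll.All (Below s) (replicate t nothing)
Below-nothings zero    = VecAll.[]
Below-nothings (suc t) = MaybeAll.nothing VecAll.∷ Below-nothings t

countTrue≤⇒hits : ∀ t s g → countTrue g s ≤ t →
  ∃ λ (os : Vec (Maybe ℕ) t) → VecAll.All (Below s) os × (∀ b → b < s → g b ≡ hits os b)
countTrue≤⇒hits t zero g _ = replicate t nothing , Below-nothings t , λ _ ()
countTrue≤⇒hits t (suc s) g few with g 0 in g0
countTrue≤⇒hits t (suc s) g few | false with countTrue≤⇒hits t s (g ∘ suc) few
... | os , os<s , e = Vec.map shift os , Below-shifts os<s , agree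
  where
  agree : ∀ b → b < suc s → g b ≡ hits (Vec.map shift os) b
  agree zero    _         = trans g0 (sym (hits-shift-zero os))
  agree (suc b) (s≤s b<s) = trans (e b b<s) (sym (hits-shift-suc os b))
countTrue≤⇒hits zero    (suc s) g () | true
countTrue≤⇒hits (suc t) (suc s) g few | true with countTrue≤⇒hits t s (g ∘ suc) (s≤s⁻¹ few)
... | os , os<s , e = just 0 ∷ Vec.map shift os , MaybeAll.just (s≤s z≤n) VecAll.∷ Below-shifts os<s , agree
  where
  agree : ∀ b → b < suc s → g b ≡ hits (just 0 ∷ Vec.map shift os) b
  agree zero    _         = g0
  agree (suc b) (s≤s b<s) = trans (e b b<s) (sym (hits-shift-suc os b))

pointsBelow : ℕ → List (Maybe ℕ)
pointsBelow s = nothing ∷ map just (upTo s)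

Below⇒∈pointsBelow : ∀ {s o} → Below s o → o ∈ pointsBelow s
Below⇒∈pointsBelow MaybeAll.nothing    = here refl
Below⇒∈pointsBelow (MaybeAll.just c<s) = there (∈-map⁺ just (∈-upTo⁺ c<s))

length-pointsBelow : ∀ s → length (pointsBelow s) ≡ suc s
length-pointsBelow s = cong suc (trans (ListP.length-map just (upTo s)) (ListP.length-upTo s))

-- Distinct submatrices of a matrix with identical rows

Unique⇒length≤ : ∀ {A : Set} {xs ys : List A} → Unique xs → xs ⊆ ys → length xs ≤ length ys
Unique⇒length≤ {xs = []}     _             _   = z≤n
Unique⇒length≤ {xs = x ∷ xs} (x∉xs ∷ !xs) xs⊆ys
  with us , vs , refl ← ∈-∃++ (xs⊆ys (here refl)) = begin
    suc (length xs)                    ≤⟨ s≤s (Unique⇒length≤ !xs xs⊆us++vs) ⟩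
    suc (length (us ++ vs))            ≡⟨ cong suc (ListP.length-++ us) ⟩
    suc (length us + length vs)        ≡⟨ sym (+-suc (length us) (length vs)) ⟩
    length us + length (x ∷ vs)        ≡⟨ sym (ListP.length-++ us) ⟩
    length (us ++ x ∷ vs)              ∎
  where
  open ≤-Reasoning
  xs⊆us++vs : xs ⊆ us ++ vs
  xs⊆us++vs {y} y∈xs with ∈-++⁻ us (xs⊆ys (there y∈xs))
  ... | inj₁ y∈us         = ∈-++⁺ˡ y∈us
  ... | inj₂ (here refl)  = contradiction refl (All.lookup x∉xs y∈xs)
  ... | inj₂ (there y∈vs) = ∈-++⁺ʳ us y∈vs

length-cartesianProduct : ∀ {A B : Set} (xs : List A) (ys : List B) →
                          length (cartesianProduct xs ys) ≡ length xs * length ys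
length-cartesianProduct []       ys = refl
length-cartesianProduct (x ∷ xs) ys =
  trans (ListP.length-++ (map (x ,_) ys))
        (cong₂ _+_ (ListP.length-map (x ,_) ys) (length-cartesianProduct xs ys))

applyUpTo-≡⇒≡ : ∀ {A : Set} {f g : ℕ → A} n → applyUpTo f n ≡ applyUpTo g n →
                ∀ b → b < n → f b ≡ g b
applyUpTo-≡⇒≡ (suc n) e zero    _         = proj₁ (ListP.∷-injective e)
applyUpTo-≡⇒≡ (suc n) e (suc b) (s≤s b<n) = applyUpTo-≡⇒≡ n (proj₂ (ListP.∷-injective e)) b b<n

map-upTo-≡⇒≡ : ∀ {A : Set} (f g : ℕ → A) n → map f (upTo n) ≡ map g (upTo n) →
               ∀ b → b < n → f b ≡ g b
map-upTo-≡⇒≡ f g n e =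
  applyUpTo-≡⇒≡ n (trans (sym (ListP.map-upTo f n)) (trans e (ListP.map-upTo g n)))

d≤length : ∀ {σ} (M : Matrix σ) n s (P : List (List (List (Fin σ)))) →
           (∀ {i j} → (i , j) ∈ positions n s → sub M s i j ∈ P) → d M n s ≤ length P
d≤length M n s P covered = Unique⇒length≤ (deduplicate-! _≟ₛ_ blocks) blocks⊆P
  where
  _≟ₛ_ = ListP.≡-dec (ListP.≡-dec FinP._≟_)
  blocks = map (λ p → sub M s (proj₁ p) (proj₂ p)) (positions n s)
  blocks⊆P : deduplicate _≟ₛ_ blocks ⊆ P
  blocks⊆P x∈ with ∈-map⁻ (λ p → sub M s (proj₁ p) (proj₂ p)) (∈-deduplicate⁻ _≟ₛ_ blocks x∈)
  ... | _ , p∈ , refl = covered p∈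

∈positions⇒column≤ : ∀ {n s i j} → (i , j) ∈ positions n s → j ∈ upTo (suc (n ∸ s))
∈positions⇒column≤ {n} {s} p∈ with Any.satisfied (∈-concatMap⁻ row {xs = upTo (suc (n ∸ s))} p∈)
  where row = λ i → map (i ,_) (upTo (suc (n ∸ s)))
... | i , p∈row with ∈-map⁻ (i ,_) p∈row
... | j , j∈ , refl = j∈

stacked : ∀ {σ} → (ℕ → Fin σ) → Matrix σ
stacked R _ j = R j

sub-stacked-≗ : ∀ {σ} (R R' : ℕ → Fin σ) s i i' j j' →
                (∀ b → b < s → R (j + b) ≡ R' (j' + b)) → sub (stacked R) s i j ≡ sub (stacked R') s i' j'
sub-stacked-≗ R R' s i i' j j' e =
  cong (λ w → map (λ _ → w) (upTo s))
       (ListP.map-cong-local (All.tabulate (λ b∈ → e _ (∈-upTo⁻ b∈))))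

sub-stacked-≡⇒≡ : ∀ {σ} (R : ℕ → Fin σ) s i i' j j' →
                  sub (stacked R) s i j ≡ sub (stacked R) s i' j' → ∀ b → b < s → R (j + b) ≡ R (j' + b)
sub-stacked-≡⇒≡ R (suc s) i i' j j' e =
  map-upTo-≡⇒≡ (λ b → R (j + b)) (λ b → R (j' + b)) (suc s) (proj₁ (ListP.∷-injective e))

d-stacked≤ : ∀ {σ} (R : ℕ → Fin σ) n s → d (stacked R) n s ≤ suc (n ∸ s)
d-stacked≤ R n s = begin
  d (stacked R) n s
    ≤⟨ d≤length (stacked R) n s columns
                (λ {i} {j} p∈ → ∈-map⁺ (sub (stacked R) s 0) (∈positions⇒column≤ {n} {s} {i} {j} p∈)) ⟩
  length columns
    ≡⟨ trans (ListP.length-map _ (upTo (suc (n ∸ s)))) (ListP.length-upTo (suc (n ∸ s))) ⟩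
  suc (n ∸ s) ∎
  where
  open ≤-Reasoning
  columns = map (sub (stacked R) s 0) (upTo (suc (n ∸ s)))

bit : Bool → Fin 2
bit false = Fin.zero
bit true  = Fin.suc Fin.zero

bit-injective : ∀ {x y} → bit x ≡ bit y → x ≡ y
bit-injective {false} {false} _ = refl
bit-injective {true}  {true}  _ = refl

d-stacked≤[1+s]² : ∀ (R : ℕ → Bool) n s → (∀ j → countTrue (λ b → R (j + b)) s ≤ 2) →
                   d (stacked (bit ∘ R)) n s ≤ suc s * suc s
d-stacked≤[1+s]² R n s sparse = begin
  d (stacked (bit ∘ R)) n s
    ≤⟨ d≤length (stacked (bit ∘ R)) n s shapes covered ⟩
  length shapes
    ≡⟨ ListP.length-map shape (cartesianProduct (pointsBelow s) (pointsBelow s)) ⟩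
  length (cartesianProduct (pointsBelow s) (pointsBelow s))
    ≡⟨ length-cartesianProduct (pointsBelow s) (pointsBelow s) ⟩
  length (pointsBelow s) * length (pointsBelow s)
    ≡⟨ cong₂ _*_ (length-pointsBelow s) (length-pointsBelow s) ⟩
  suc s * suc s ∎
  where
  open ≤-Reasoning
  shape : Maybe ℕ × Maybe ℕ → List (List (Fin 2))
  shape (o₁ , o₂) = sub (stacked (bit ∘ hits (o₁ ∷ o₂ ∷ []))) s 0 0
  shapes = map shape (cartesianProduct (pointsBelow s) (pointsBelow s))
  covered : ∀ {i j} → (i , j) ∈ positions n s → sub (stacked (bit ∘ R)) s i j ∈ shapes
  covered {i} {j} _ with countTrue≤⇒hits 2 s (λ b → R (j + b)) (sparse j)
  ... | o₁ ∷ o₂ ∷ [] , o₁<s VecAll.∷ o₂<s VecAll.∷ VecAll.[] , e =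
    subst (_∈ shapes)
          (sym (sub-stacked-≗ (bit ∘ R) (bit ∘ hits (o₁ ∷ o₂ ∷ [])) s i 0 j 0
                              (λ b b<s → cong bit (e b b<s))))
          (∈-map⁺ shape (∈-cartesianProduct⁺ (Below⇒∈pointsBelow o₁<s) (Below⇒∈pointsBelow o₂<s)))

-- Marked nodes above a first occurrence

ShareCell-own-block : ∀ S .{{_ : NonZero S}} i j → ShareCell S ((i / S) * S) ((j / S) * S) i j
ShareCell-own-block S i j = i , j , own i , own j
  where
  below-next : ∀ x → x < x / S * S + S
  below-next x = begin-strict
    x                  ≡⟨ m≡m%n+[m/n]*n x S ⟩
    x % S + x / S * S  <⟨ +-monoˡ-< (x / S * S) (m%n<n x S) ⟩
    S + x / S * S      ≡⟨ +-comm S (x / S * S) ⟩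
    x / S * S + S      ∎
    where open ≤-Reasoning
  own : ∀ x → x / S * S ≤ x × x < x / S * S + S × x ≤ x × x < x + S
  own x = m/n*n≤m x S , below-next x , ≤-refl , m<m+n x (>-nonZero⁻¹ S)

module _ {σ} (k β : ℕ) .{{_ : NonZero k}} (M : Matrix σ) where

  blockOf : ℕ → ℕ → ℕ
  blockOf ℓ x = (x / k ^ (β ∸ ℓ)) {{m^n≢0 k (β ∸ ℓ)}}

  marked-containing : ∀ ℓ i j → ℓ ≤ β → i < k ^ β → j < k ^ β →
    (∀ ℓ' → ℓ' < ℓ → FirstOcc M (k ^ β) (k ^ (β ∸ suc ℓ')) i j) →
    Marked k β M ℓ (blockOf ℓ i) (blockOf ℓ j)
  marked-containing zero i j _ i<n j<n _ =
    subst₂ (Marked k β M 0) (sym (m<n⇒m/n≡0 i<n)) (sym (m<n⇒m/n≡0 j<n)) root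
    where instance _ = m^n≢0 k β
  marked-containing (suc ℓ) i j ℓ<β i<n j<n firstOcc =
    subst₂ (Marked k β M (suc ℓ)) (digits i) (digits j)
      (child parent ℓ<β (m%n<n (i / S) k) (m%n<n (j / S) k)
        (i , j , firstOcc ℓ ≤-refl ,
         subst₂ (λ x y → ShareCell S (x * S) (y * S) i j) (sym (digits i)) (sym (digits j))
                (ShareCell-own-block S i j)))
    where
    S = k ^ (β ∸ suc ℓ)
    instance
      S-nonZero : NonZero S
      S-nonZero = m^n≢0 k (β ∸ suc ℓ)
      S*k-nonZero : NonZero (S * k)
      S*k-nonZero = m*n≢0 S k
    digits : ∀ x → x / S / k * k + x / S % k ≡ x / S
    digits x = trans (+-comm (x / S / k * k) (x / S % k)) (sym (m≡m%n+[m/n]*n (x / S) k))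
    parent-index : ∀ x → blockOf ℓ x ≡ x / S / k
    parent-index x = begin
      blockOf ℓ x      ≡⟨ /-congʳ {{m^n≢0 k (β ∸ ℓ)}} (trans (^-∸-suc k ℓ<β) (*-comm k S)) ⟩
      x / (S * k)      ≡⟨ sym (m/n/o≡m/[n*o] x S k) ⟩
      x / S / k        ∎
      where open ≡-Reasoning
    parent : Marked k β M ℓ (i / S / k) (j / S / k)
    parent = subst₂ (Marked k β M ℓ) (parent-index i) (parent-index j)
      (marked-containing ℓ i j (<⇒≤ ℓ<β) i<n j<n (λ ℓ' ℓ'<ℓ → firstOcc ℓ' (m<n⇒m<1+n ℓ'<ℓ)))

halfOdd : ℕ → Maybe ℕ
halfOdd zero          = nothing
halfOdd (suc zero)    = just 0
halfOdd (suc (suc u)) = Maybe.map suc (halfOdd u)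

halfOdd-odd : ∀ w → halfOdd (suc (w + w)) ≡ just w
halfOdd-odd zero = refl
halfOdd-odd (suc w) rewrite +-suc w w | halfOdd-odd w = refl

halfOdd-just : ∀ {u w} → halfOdd u ≡ just w → u ≡ suc (w + w)
halfOdd-just {suc zero} refl = refl
halfOdd-just {suc (suc u)} e with halfOdd u in hu
halfOdd-just {suc (suc u)} refl | just w =
  cong (2 +_) (trans (halfOdd-just hu) (sym (+-suc w w)))

halfOdd-even : ∀ u → halfOdd u ≡ nothing ⊎ halfOdd (suc u) ≡ nothing
halfOdd-even zero          = inj₁ refl
halfOdd-even (suc zero)    = inj₂ refl
halfOdd-even (suc (suc u)) with halfOdd-even u
... | inj₁ e rewrite e = inj₁ refl
... | inj₂ e rewrite e = inj₂ refl

blockPoints : Maybe ℕ → Vec (Maybe ℕ) 2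
blockPoints nothing  = nothing ∷ nothing ∷ []
blockPoints (just w) = just 0 ∷ just (suc w) ∷ []

block : ℕ → ℕ → Bool
block u = hits (blockPoints (halfOdd u))

countTrue-evenBlock : ∀ u → halfOdd u ≡ nothing → ∀ s → countTrue (block u) s ≡ 0
countTrue-evenBlock u e s = trans (cong (λ o → countTrue (hits (blockPoints o)) s) e) (countTrue-false s)

countTrue-adjacent-blocks : ∀ u s → countTrue (block u) s + countTrue (block (suc u)) s ≤ 2
countTrue-adjacent-blocks u s with halfOdd-even u
... | inj₁ e = subst (_≤ 2) (cong (_+ countTrue (block (suc u)) s) (sym (countTrue-evenBlock u e s)))
                    (countTrue-hits (blockPoints (halfOdd (suc u))) s)
... | inj₂ e = subst (_≤ 2) (trans (sym (+-identityʳ _))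
                                   (cong (countTrue (block u) s +_) (sym (countTrue-evenBlock (suc u) e s))))
                    (countTrue-hits (blockPoints (halfOdd u)) s)

oddBlock-true : ∀ w r → hits (blockPoints (just w)) r ≡ true → r ≡ 0 ⊎ r ≡ suc w
oddBlock-true w zero    _ = inj₁ refl
oddBlock-true w (suc r) e = inj₂ (cong suc (≡ᵇ-true (trans (sym (∨-identityʳ (r ≡ᵇ w))) e)))

oddBlock-mark : ∀ w → hits (blockPoints (just w)) (suc w) ≡ true
oddBlock-mark w = cong (_∨ false) (≡ᵇ-refl w)

oddBlock-unmarked : ∀ {w c} → c ≢ w → hits (blockPoints (just w)) (suc c) ≡ false
oddBlock-unmarked c≢w = cong (_∨ false) (≡ᵇ-≢ c≢w)

module Construction (k : ℕ) (2≤k : 2 ≤ k) (m : ℕ) where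

  instance
    k-nonZero : NonZero k
    k-nonZero = >-nonZero (≤-trans (s≤s z≤n) 2≤k)

  V γ s₀ β n : ℕ
  V  = k ^ m
  γ  = 2 + m
  s₀ = k ^ γ
  β  = γ + γ
  n  = k ^ β

  instance
    s₀-nonZero : NonZero s₀
    s₀-nonZero = m^n≢0 k γ
    V-nonZero : NonZero V
    V-nonZero = m^n≢0 k m

  n≡s₀*s₀ : n ≡ s₀ * s₀
  n≡s₀*s₀ = ^-distribˡ-+-* k γ γ

  V+V<s₀ : V + V < s₀
  V+V<s₀ = begin-strict
    V + V              <⟨ m<m+n (V + V) (≤-trans (>-nonZero⁻¹ V) (m≤m+n V V)) ⟩
    (V + V) + (V + V)  ≡⟨ quadruple V ⟩
    2 * (2 * V)        ≤⟨ *-mono-≤ 2≤k (*-monoˡ-≤ V 2≤k) ⟩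
    s₀                 ∎
    where
    open ≤-Reasoning
    quadruple : ∀ x → (x + x) + (x + x) ≡ 2 * (2 * x)
    quadruple = solve-∀

  row : ℕ → Bool
  row j = block (j / s₀) (j % s₀)

  M : Matrix 2
  M = stacked (bit ∘ row)

  row-block : ∀ {r} u → r < s₀ → row (r + u * s₀) ≡ block u r
  row-block {r} u r<s₀ = cong₂ block quotient remainder
    where
    quotient : (r + u * s₀) / s₀ ≡ u
    quotient = begin
      (r + u * s₀) / s₀        ≡⟨ +-distrib-/-∣ʳ r (n∣m*n u) ⟩
      r / s₀ + u * s₀ / s₀     ≡⟨ cong₂ _+_ (m<n⇒m/n≡0 r<s₀) (m*n/n≡m u s₀) ⟩
      u                        ∎
      where open ≡-Reasoning
    remainder : (r + u * s₀) % s₀ ≡ r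
    remainder = trans ([m+kn]%n≡m%n r u s₀) (m<n⇒m%n≡m r<s₀)

  row-in-block : ∀ j b → j % s₀ + b < s₀ → row (j + b) ≡ block (j / s₀) (j % s₀ + b)
  row-in-block j b bound = trans (cong row shuffle) (row-block (j / s₀) bound)
    where
    shuffle : j + b ≡ (j % s₀ + b) + j / s₀ * s₀
    shuffle = trans (cong (_+ b) (m≡m%n+[m/n]*n j s₀)) (+-right-comm (j % s₀) (j / s₀ * s₀) b)

  countTrue-window : ∀ j s → s ≤ s₀ → countTrue (λ b → row (j + b)) s ≤ 2
  countTrue-window j s s≤s₀ = begin
    countTrue (λ b → row (j + b)) s
      ≡⟨ countTrue-cong s (λ b _ → cong row (shuffle b)) ⟩
    countTrue (λ b → H (r + b)) s
      ≤⟨ m≤n+m _ (countTrue H r) ⟩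
    countTrue H r + countTrue (λ b → H (r + b)) s
      ≡⟨ sym (countTrue-+ r s H) ⟩
    countTrue H (r + s)
      ≤⟨ countTrue-mono H (+-mono-≤ (<⇒≤ (m%n<n j s₀)) s≤s₀) ⟩
    countTrue H (s₀ + s₀)
      ≡⟨ countTrue-+ s₀ s₀ H ⟩
    countTrue H s₀ + countTrue (λ b → H (s₀ + b)) s₀
      ≡⟨ cong₂ _+_ (countTrue-cong s₀ (λ b → row-block u))
                   (countTrue-cong s₀ (λ b b<s₀ → trans (cong row (next b)) (row-block (suc u) b<s₀))) ⟩
    countTrue (block u) s₀ + countTrue (block (suc u)) s₀
      ≤⟨ countTrue-adjacent-blocks u s₀ ⟩
    2 ∎
    where
    open ≤-Reasoning
    r = j % s₀
    u = j / s₀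
    H : ℕ → Bool
    H x = row (x + u * s₀)
    shuffle : ∀ b → j + b ≡ (r + b) + u * s₀
    shuffle b = trans (cong (_+ b) (m≡m%n+[m/n]*n j s₀)) (+-right-comm r (u * s₀) b)
    next : ∀ b → (s₀ + b) + u * s₀ ≡ b + suc u * s₀
    next b = trans (cong (_+ u * s₀) (+-comm s₀ b)) (+-assoc b s₀ (u * s₀))

  δ2D-bound : δ2D≤ M n 4
  δ2D-bound s 1≤s s≤n with s <? s₀
  ... | yes s<s₀ = begin
    d M n s        ≤⟨ d-stacked≤[1+s]² row n s (λ j → countTrue-window j s (<⇒≤ s<s₀)) ⟩
    suc s * suc s  ≤⟨ *-mono-≤ 1+s≤2s 1+s≤2s ⟩
    (2 * s) * (2 * s) ≡⟨ square-double s ⟩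
    4 * (s * s)    ∎
    where
    open ≤-Reasoning
    square-double : ∀ x → (2 * x) * (2 * x) ≡ 4 * (x * x)
    square-double = solve-∀
    1+s≤2s : suc s ≤ 2 * s
    1+s≤2s = subst (_≤ 2 * s) (+-comm s 1) (+-monoʳ-≤ s (≤-trans 1≤s (m≤m+n s 0)))
  ... | no s≮s₀ = begin
    d M n s       ≤⟨ d-stacked≤ (bit ∘ row) n s ⟩
    suc (n ∸ s)   ≤⟨ ∸-monoʳ-< 1≤s s≤n ⟩
    n             ≡⟨ n≡s₀*s₀ ⟩
    s₀ * s₀       ≤⟨ *-mono-≤ (≮⇒≥ s≮s₀) (≮⇒≥ s≮s₀) ⟩
    s * s         ≤⟨ m≤n*m (s * s) 4 ⟩
    4 * (s * s)   ∎
    where open ≤-Reasoning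

  module OddColumn (v : ℕ) (v<V : v < V) where

    u p : ℕ
    u = suc (v + v)
    p = u * s₀

    instance
      p-nonZero : NonZero p
      p-nonZero = m*n≢0 u s₀

    row-p : ∀ b → b < s₀ → row (p + b) ≡ hits (blockPoints (just v)) b
    row-p b b<s₀ =
      trans (cong row (+-comm p b))
            (trans (row-block u b<s₀) (cong (λ o → hits (blockPoints o) b) (halfOdd-odd v)))

    differs-at : ∀ {j b x} → row (j + b) ≡ x → row (p + b) ≡ not x → row (j + b) ≢ row (p + b)
    differs-at left right same = not-¬ refl (trans (sym left) (trans same right))

    -- An earlier window starting with a one starts at offset 0 or w + 1 of an
    -- odd block 2w + 1 with w < v.  In the first case its next one is at offset
    -- w + 1; in the second it has no other one among its first s₀ − w − 1 > v + 1
    -- entries.  The window at p has its second one at offset v + 1.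
    earlier-window-differs : ∀ j → j < p → ∃ λ b → b < s₀ × row (j + b) ≢ row (p + b)
    earlier-window-differs j j<p with row j in rj
    ... | false = 0 , 0<s₀ , differs-at (trans (cong row (+-identityʳ j)) rj) (row-p 0 0<s₀)
      where 0<s₀ = ≤-<-trans z≤n V+V<s₀
    ... | true with halfOdd (j / s₀) in hj | rj
    ...   | just w | rj′ = differ (oddBlock-true w (j % s₀) rj′)
      where
      w<v : w < v
      w<v = ≰⇒> λ v≤w → <⇒≱ (m<n*o⇒m/o<n j<p)
                             (subst (u ≤_) (sym (halfOdd-just hj)) (s≤s (+-mono-≤ v≤w v≤w)))
      w+1+v+1<s₀ : suc w + suc v < s₀
      w+1+v+1<s₀ = ≤-<-trans (≤-trans (+-mono-≤ w<v v<V) (+-monoˡ-≤ V (<⇒≤ v<V))) V+V<s₀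
      w+1<s₀ : suc w < s₀
      w+1<s₀ = ≤-<-trans (m≤m+n (suc w) (suc v)) w+1+v+1<s₀
      v+1<s₀ : suc v < s₀
      v+1<s₀ = ≤-<-trans (m≤n+m (suc v) (suc w)) w+1+v+1<s₀
      row-j : ∀ {r} b → j % s₀ ≡ r → r + b < s₀ → row (j + b) ≡ hits (blockPoints (just w)) (r + b)
      row-j b refl bound =
        trans (row-in-block j b bound) (cong (λ o → hits (blockPoints o) (j % s₀ + b)) hj)
      differ : j % s₀ ≡ 0 ⊎ j % s₀ ≡ suc w → ∃ λ b → b < s₀ × row (j + b) ≢ row (p + b)
      differ (inj₁ r≡0) = suc w , w+1<s₀ ,
        differs-at (trans (row-j (suc w) r≡0 w+1<s₀) (oddBlock-mark w))
                   (trans (row-p (suc w) w+1<s₀) (oddBlock-unmarked (<⇒≢ w<v)))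
      differ (inj₂ r≡w+1) = suc v , v+1<s₀ ,
        differs-at (trans (row-j (suc v) r≡w+1 w+1+v+1<s₀) (oddBlock-unmarked (m+1+n≢m w)))
                   (trans (row-p (suc v) v+1<s₀) (oddBlock-mark v))

    p*k≤n : p * k ≤ n
    p*k≤n = begin
      u * s₀ * k            ≤⟨ *-monoˡ-≤ k (*-monoˡ-≤ s₀ (+-mono-≤ v<V (<⇒≤ v<V))) ⟩
      (V + V) * s₀ * k      ≡⟨ cong (λ x → (V + x) * s₀ * k) (sym (+-identityʳ V)) ⟩
      (2 * V) * s₀ * k      ≤⟨ *-monoˡ-≤ k (*-monoˡ-≤ s₀ (*-monoˡ-≤ V 2≤k)) ⟩
      (k * V) * s₀ * k      ≡⟨ rearrange k V s₀ ⟩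
      s₀ * s₀               ≡⟨ sym n≡s₀*s₀ ⟩
      n                     ∎
      where
      open ≤-Reasoning
      rearrange : ∀ k V s → k * V * s * k ≡ s * (k * (k * V))
      rearrange = solve-∀

    p<n : p < n
    p<n = <-≤-trans (m<m*n p k 2≤k) p*k≤n

    firstOcc-odd : ∀ S → s₀ ≤ S → S * k ≤ n → FirstOcc M n S 0 p
    firstOcc-odd S s₀≤S S*k≤n = m+n≤o⇒n≤o p p+S≤n , p+S≤n , earlier
      where
      p+S≤n : p + S ≤ n
      p+S≤n = +-≤-of-*-≤ {p} {S} 2≤k p*k≤n S*k≤n
      earlier : ∀ i' j' → i' + S ≤ n → j' + S ≤ n → Before (i' , j') (0 , p) →
                sub M S i' j' ≢ sub M S 0 p
      earlier i' j' _ _ (inj₂ (_ , j'<p)) same with earlier-window-differs j' j'<p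
      ... | b , b<s₀ , differ =
        differ (bit-injective (sub-stacked-≡⇒≡ (bit ∘ row) S i' 0 j' p same b (<-≤-trans b<s₀ s₀≤S)))

    firstOcc-above-γ : ∀ ℓ → ℓ < γ → FirstOcc M n (k ^ (β ∸ suc ℓ)) 0 p
    firstOcc-above-γ ℓ ℓ<γ = firstOcc-odd (k ^ (β ∸ suc ℓ)) s₀≤S S*k≤n
      where
      s₀≤S : s₀ ≤ k ^ (β ∸ suc ℓ)
      s₀≤S = ^-monoʳ-≤ k (subst (_≤ β ∸ suc ℓ) (m+n∸n≡m γ γ) (∸-monoʳ-≤ β ℓ<γ))
      S*k≤n : k ^ (β ∸ suc ℓ) * k ≤ n
      S*k≤n = begin
        k ^ (β ∸ suc ℓ) * k  ≡⟨ *-comm (k ^ (β ∸ suc ℓ)) k ⟩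
        k * k ^ (β ∸ suc ℓ)  ≡⟨ sym (^-∸-suc k (≤-trans ℓ<γ (m≤m+n γ γ))) ⟩
        k ^ (β ∸ ℓ)          ≤⟨ ^-monoʳ-≤ k (m∸n≤m β ℓ) ⟩
        n                    ∎
        where open ≤-Reasoning

    marked-at-γ : Marked k β M γ 0 u
    marked-at-γ = subst₂ (Marked k β M γ) (trans (blockOf-γ 0) (0/n≡0 s₀)) (trans (blockOf-γ p) (m*n/n≡m u s₀))
      (marked-containing k β M γ 0 p (m≤m+n γ γ) (≤-<-trans z≤n p<n) p<n firstOcc-above-γ)
      where
      blockOf-γ : ∀ x → blockOf k β M γ x ≡ x / s₀
      blockOf-γ x = /-congʳ {{m^n≢0 k (β ∸ γ)}} (cong (k ^_) (m+n∸n≡m γ γ))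

  oddColumns : List (ℕ × ℕ)
  oddColumns = map (λ v → 0 , suc (v + v)) (upTo V)

  oddColumns-unique : Unique oddColumns
  oddColumns-unique = UniqueP.map⁺ distinct (UniqueP.upTo⁺ V)
    where
    distinct : ∀ {v w} → (0 , suc (v + v)) ≡ (0 , suc (w + w)) → v ≡ w
    distinct {v} {w} e =
      just-injective (trans (sym (halfOdd-odd v)) (trans (cong (halfOdd ∘ proj₂) e) (halfOdd-odd w)))

  oddColumns-marked : All (λ c → Marked k β M γ (proj₁ c) (proj₂ c)) oddColumns
  oddColumns-marked = AllP.map⁺ (All.tabulate (λ {v} v∈ → OddColumn.marked-at-γ v (∈-upTo⁻ v∈)))

  n≤k⁴|oddColumns|² : n ≤ k * (k * (k * k)) * (length oddColumns * length oddColumns)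
  n≤k⁴|oddColumns|² = ≤-reflexive (begin
    n                   ≡⟨ n≡s₀*s₀ ⟩
    s₀ * s₀             ≡⟨ rearrange k V ⟩
    k * (k * (k * k)) * (V * V)     ≡⟨ cong (λ x → k * (k * (k * k)) * (x * x)) (sym length-oddColumns) ⟩
    k * (k * (k * k)) * (length oddColumns * length oddColumns) ∎)
    where
    open ≡-Reasoning
    rearrange : ∀ k V → (k * (k * V)) * (k * (k * V)) ≡ k * (k * (k * k)) * (V * V)
    rearrange = solve-∀
    length-oddColumns : length oddColumns ≡ V
    length-oddColumns = trans (ListP.length-map _ (upTo V)) (ListP.length-upTo V)

lemma7 : ∀ k → 2 ≤ k →
    ∃ λ σ → ∃ λ c → ∃ λ C →
    ∀ m → ∃ λ β → m ≤ β × ∃ λ (M : Matrix σ) →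
    δ2D≤ M (k ^ β) c ×
    ∃ λ ℓ → ℓ ≤ β × ∃ λ (L : List (ℕ × ℕ)) →
    Unique L × All (λ p → Marked k β M ℓ (proj₁ p) (proj₂ p)) L ×
    k ^ β ≤ C * (length L * length L)
lemma7 k 2≤k = 2 , 4 , k * (k * (k * k)) , λ m → let open Construction k 2≤k m in
  β , ≤-trans (m≤n+m m 2) (m≤m+n γ γ) , M , δ2D-bound ,
  γ , m≤m+n γ γ , oddColumns , oddColumns-unique , oddColumns-marked , n≤k⁴|oddColumns|²
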